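{- Let $d\ge 2$ be an integer and let $n=d+2$. Then there exists a homogeneous form $f_d\in\mathbb{F}_2[x_1,\dots,x_n]$ of degree $d$ such that its zero set $Z(f_d,\mathbb{F}_2^n)=\{a\in\mathbb{F}_2^n: f_d(a)=0\}$ has exactly $6=2^{n-d}+2$ elements and $Z(f_d,\mathbb{F}_2^n)$ is not an affine space in $\mathbb{F}_2^n$.
   Context: An affine space in $\mathbb{F}_2^n$ is a coset of an $\mathbb{F}_2$-linear subspace. A homogeneous form of degree $d$ is a nonzero polynomial all of whose monomials have degree $d$. -}

module Defs where

open import Data.Bool using (Bool; true; false; _∧_; _xor_)
open import Data.Nat using (ℕ; zero; suc; _+_)
open import Data.Vec using (Vec; []; _∷_; zipWith; replicate; map)
open import Data.List using (List; []; _∷_; _++_; length; filter; foldr)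
import Data.List as L
open import Data.List.Relation.Unary.All using (All)
open import Data.List.Relation.Unary.Unique.Propositional using (Unique)
open import Data.Product using (Σ; _×_; ∃)
open import Data.Bool.Properties using (T?)
open import Relation.Binary.PropositionalEquality using (_≡_)
open import Relation.Nullary using (¬_)

-- 𝔽₂ is modelled by Bool: addition = xor, multiplication = ∧.

Monomial : ℕ → Set
Monomial n = Vec ℕ n

degree : ∀ {n} → Monomial n → ℕ
degree [] = 0
degree (e ∷ es) = e + degree es

-- A polynomial in 𝔽₂[x₁,…,xₙ] is a finite sum of distinct monomials
-- (every coefficient is 0 or 1): the list of monomials with coefficient 1.
-- Distinctness makes this representation canonical.
record Poly (n : ℕ) : Set where
  constructor poly
  field
    monomials : List (Monomial n)
    distinct  : Unique monomials
open Poly public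

NonZeroPoly : ∀ {n} → Poly n → Set
NonZeroPoly f = ¬ (monomials f ≡ [])

IsHomogeneousForm : ∀ {n} → ℕ → Poly n → Set
IsHomogeneousForm d f = NonZeroPoly f × All (λ m → degree m ≡ d) (monomials f)

pow : Bool → ℕ → Bool
pow b zero = true
pow b (suc k) = b ∧ pow b k

evalMon : ∀ {n} → Monomial n → Vec Bool n → Bool
evalMon [] [] = true
evalMon (e ∷ es) (a ∷ as) = pow a e ∧ evalMon es as

eval : ∀ {n} → Poly n → Vec Bool n → Bool
eval f a = foldr (λ m acc → evalMon m a xor acc) false (monomials f)

Z : ∀ {n} → Poly n → Vec Bool n → Set
Z f a = eval f a ≡ false

allPoints : (n : ℕ) → List (Vec Bool n)
allPoints zero = [] ∷ []
allPoints (suc n) = L.map (false ∷_) (allPoints n) ++ L.map (true ∷_) (allPoints n)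

isZero : Bool → Bool
isZero false = true
isZero true = false

zeroSetSize : ∀ {n} → Poly n → ℕ
zeroSetSize {n} f = length (filter (λ a → T? (isZero (eval f a))) (allPoints n))

_⊕_ : ∀ {n} → Vec Bool n → Vec Bool n → Vec Bool n
_⊕_ = zipWith _xor_

_·_ : ∀ {n} → Bool → Vec Bool n → Vec Bool n
c · v = map (c ∧_) v

𝟎 : ∀ {n} → Vec Bool n
𝟎 = replicate _ false

record IsLinearSubspace {n : ℕ} (V : Vec Bool n → Set) : Set where
  field
    has-zero  : V 𝟎
    add-closed : ∀ {u v} → V u → V v → V (u ⊕ v)
    smul-closed : ∀ c {v} → V v → V (c · v)

IsAffineSpace : ∀ {n} → (Vec Bool n → Set) → Set₁
IsAffineSpace {n} S =
  Σ (Vec Bool n) λ p → Σ (Vec Bool n → Set) λ V →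
    IsLinearSubspace V ×
    (∀ a → (S a → Σ (Vec Bool n) λ v → V v × a ≡ p ⊕ v)
         × (∀ v → V v → a ≡ p ⊕ v → S a))

-- The elementary symmetric form σ₂ in four variables vanishes exactly on the points of weight
-- 0, 1 and 4 of 𝔽₂⁴ (six points), and 0, e₁, e₂ are zeros while e₁ + e₂ is not; an affine space
-- contains a + b + c whenever it contains a, b, c, so Z(σ₂) is not affine. To raise the degree
-- from d + 1 to d + 2, adjoin a variable x₀ and take x₀^(d+2) + x₀ f + f↑, where f↑ is f with one
-- exponent raised in each monomial: since x² = x on 𝔽₂ it agrees with f as a function. The new
-- form equals f on x₀ = 0 and 1 on x₀ = 1, so its zero set is {0} × Z(f).
module Submission where

open import Defs
open import Data.Bool using (Bool; true; false; _∧_; _xor_)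
open import Data.Bool.Properties using (T?; ∧-assoc; ∧-idem; xor-assoc; xor-same; xor-identityʳ)
open import Data.List using (List; []; _∷_; _++_; length; filter; foldr)
import Data.List as L
open import Data.List.Properties using (length-++; filter-++)
open import Data.List.Relation.Unary.All as All using (All; []; _∷_)
import Data.List.Relation.Unary.All.Properties as All
open import Data.List.Relation.Unary.AllPairs as AllPairs using (AllPairs; []; _∷_)
import Data.List.Relation.Unary.AllPairs.Properties as AllPairs
open import Data.Nat using (ℕ; zero; suc; _+_; _≤_; s≤s; z≤n)
open import Data.Nat.Properties using (+-identityʳ)
open import Data.Product using (Σ; _×_; _,_; proj₁; proj₂)
open import Data.Vec using (Vec; []; _∷_; replicate)
open import Data.Vec.Properties using (∷-injectiveʳ)
open import Function using (_∘_)
open import Relation.Binary.PropositionalEquality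
  using (_≡_; _≢_; _≗_; refl; sym; trans; cong; cong₂; module ≡-Reasoning)
open import Relation.Nullary using (¬_)

open ≡-Reasoning

raise : ∀ {n} → Monomial n → Monomial n
raise []           = []
raise (zero  ∷ es) = zero ∷ raise es
raise (suc e ∷ es) = suc (suc e) ∷ es

evalMon-raise : ∀ {n} (m : Monomial n) (a : Vec Bool n) → evalMon (raise m) a ≡ evalMon m a
evalMon-raise []           []       = refl
evalMon-raise (zero  ∷ es) (x ∷ xs) = evalMon-raise es xs
evalMon-raise (suc e ∷ es) (x ∷ xs) = cong (_∧ evalMon es xs) (begin
  x ∧ (x ∧ pow x e) ≡⟨ sym (∧-assoc x x (pow x e)) ⟩
  (x ∧ x) ∧ pow x e ≡⟨ cong (_∧ pow x e) (∧-idem x) ⟩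
  x ∧ pow x e       ∎)

degree-raise : ∀ {n k} (m : Monomial n) → degree m ≡ suc k → degree (raise m) ≡ suc (suc k)
degree-raise (zero  ∷ es) eq = degree-raise es eq
degree-raise (suc e ∷ es) eq = cong suc eq

raise-injective : ∀ {n} (m m′ : Monomial n) → raise m ≡ raise m′ → m ≡ m′
raise-injective []           []            eq   = refl
raise-injective (zero  ∷ es) (zero  ∷ es′) eq   = cong (zero ∷_) (raise-injective es es′ (∷-injectiveʳ eq))
raise-injective (suc e ∷ es) (suc .e ∷ es′) refl = refl

degree-replicate-0 : ∀ n → degree (replicate n 0) ≡ 0
degree-replicate-0 zero    = refl
degree-replicate-0 (suc n) = degree-replicate-0 n

evalMon-replicate-0 : ∀ {n} (a : Vec Bool n) → evalMon (replicate n 0) a ≡ true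
evalMon-replicate-0 []       = refl
evalMon-replicate-0 (x ∷ xs) = evalMon-replicate-0 xs

pow-true : ∀ k → pow true k ≡ true
pow-true zero    = refl
pow-true (suc k) = pow-true k

evalMonomials : ∀ {n} → List (Monomial n) → Vec Bool n → Bool
evalMonomials ms a = foldr (λ m acc → evalMon m a xor acc) false ms

evalMonomials-++ : ∀ {n} (ms ms′ : List (Monomial n)) (a : Vec Bool n) →
  evalMonomials (ms ++ ms′) a ≡ evalMonomials ms a xor evalMonomials ms′ a
evalMonomials-++ []       ms′ a = refl
evalMonomials-++ (m ∷ ms) ms′ a = begin
  evalMon m a xor evalMonomials (ms ++ ms′) a
    ≡⟨ cong (evalMon m a xor_) (evalMonomials-++ ms ms′ a) ⟩
  evalMon m a xor (evalMonomials ms a xor evalMonomials ms′ a)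
    ≡⟨ sym (xor-assoc (evalMon m a) _ _) ⟩
  (evalMon m a xor evalMonomials ms a) xor evalMonomials ms′ a ∎

raised : ∀ {n} → Monomial n → Monomial (suc n)
raised m = 0 ∷ raise m

timesX₀ : ∀ {n} → Monomial n → Monomial (suc n)
timesX₀ m = 1 ∷ m

evalMonomials-raised : ∀ {n} (ms : List (Monomial n)) (x : Bool) (a : Vec Bool n) →
  evalMonomials (L.map raised ms) (x ∷ a) ≡ evalMonomials ms a
evalMonomials-raised []       x a = refl
evalMonomials-raised (m ∷ ms) x a = cong₂ _xor_ (evalMon-raise m a) (evalMonomials-raised ms x a)

evalMonomials-timesX₀ : ∀ {n} (ms : List (Monomial n)) (x : Bool) (a : Vec Bool n) →
  evalMonomials (L.map timesX₀ ms) (x ∷ a) ≡ x ∧ evalMonomials ms a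
evalMonomials-timesX₀ ms false a = zero-sum ms
  where
  zero-sum : ∀ ms → evalMonomials (L.map timesX₀ ms) (false ∷ a) ≡ false
  zero-sum []       = refl
  zero-sum (m ∷ ms) = zero-sum ms
evalMonomials-timesX₀ []       true a = refl
evalMonomials-timesX₀ (m ∷ ms) true a = cong (evalMon m a xor_) (evalMonomials-timesX₀ ms true a)

extendMonomials : ∀ {n} → ℕ → List (Monomial n) → List (Monomial (suc n))
extendMonomials {n} d ms = (suc (suc d) ∷ replicate n 0) ∷ L.map raised ms ++ L.map timesX₀ ms

extendMonomials-unique : ∀ {n} d (ms : List (Monomial n)) →
  AllPairs _≢_ ms → AllPairs _≢_ (extendMonomials d ms)
extendMonomials-unique d ms distinct =
  All.++⁺ (All.map⁺ (All.universal (λ _ ()) ms)) (All.map⁺ (All.universal (λ _ ()) ms))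
  ∷ AllPairs.++⁺ (AllPairs.map⁺ raised-distinct) (AllPairs.map⁺ timesX₀-distinct) raised≢timesX₀
  where
  raised-distinct : AllPairs (λ m m′ → raised m ≢ raised m′) ms
  raised-distinct = AllPairs.map (λ {m} {m′} m≢m′ → m≢m′ ∘ raise-injective m m′ ∘ ∷-injectiveʳ) distinct
  timesX₀-distinct : AllPairs (λ m m′ → timesX₀ m ≢ timesX₀ m′) ms
  timesX₀-distinct = AllPairs.map (λ m≢m′ → m≢m′ ∘ ∷-injectiveʳ) distinct
  raised≢timesX₀ : All (λ m → All (m ≢_) (L.map timesX₀ ms)) (L.map raised ms)
  raised≢timesX₀ = All.map⁺ (All.universal (λ _ → All.map⁺ (All.universal (λ _ ()) ms)) ms)

extendMonomials-homogeneous : ∀ {n} d (ms : List (Monomial n)) →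
  All (λ m → degree m ≡ suc d) ms → All (λ m → degree m ≡ suc (suc d)) (extendMonomials d ms)
extendMonomials-homogeneous {n} d ms homogeneous =
  trans (cong (suc (suc d) +_) (degree-replicate-0 n)) (+-identityʳ _)
  ∷ All.++⁺ (All.map⁺ (All.map (λ {m} → degree-raise m) homogeneous))
            (All.map⁺ (All.map (cong suc) homogeneous))

extend : ∀ {n} → ℕ → Poly n → Poly (suc n)
extend d f = poly (extendMonomials d (monomials f)) (extendMonomials-unique d (monomials f) (distinct f))

extend-isHomogeneousForm : ∀ {n} d (f : Poly n) →
  All (λ m → degree m ≡ suc d) (monomials f) → IsHomogeneousForm (suc (suc d)) (extend d f)
extend-isHomogeneousForm d f homogeneous =
  (λ ()) , extendMonomials-homogeneous d (monomials f) homogeneous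

eval-extend-tail : ∀ {n} (f : Poly n) x (a : Vec Bool n) →
  evalMonomials (L.map raised (monomials f) ++ L.map timesX₀ (monomials f)) (x ∷ a)
    ≡ eval f a xor (x ∧ eval f a)
eval-extend-tail f x a = begin
  evalMonomials (L.map raised ms ++ L.map timesX₀ ms) (x ∷ a)
    ≡⟨ evalMonomials-++ (L.map raised ms) (L.map timesX₀ ms) (x ∷ a) ⟩
  evalMonomials (L.map raised ms) (x ∷ a) xor evalMonomials (L.map timesX₀ ms) (x ∷ a)
    ≡⟨ cong₂ _xor_ (evalMonomials-raised ms x a) (evalMonomials-timesX₀ ms x a) ⟩
  eval f a xor (x ∧ eval f a) ∎
  where ms = monomials f

eval-extend-false : ∀ {n} d (f : Poly n) (a : Vec Bool n) → eval (extend d f) (false ∷ a) ≡ eval f a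
eval-extend-false d f a = trans (eval-extend-tail f false a) (xor-identityʳ (eval f a))

eval-extend-true : ∀ {n} d (f : Poly n) (a : Vec Bool n) → eval (extend d f) (true ∷ a) ≡ true
eval-extend-true {n} d f a = begin
  (pow true (suc (suc d)) ∧ evalMon (replicate n 0) a)
    xor evalMonomials (L.map raised (monomials f) ++ L.map timesX₀ (monomials f)) (true ∷ a)
    ≡⟨ cong₂ _xor_ (cong₂ _∧_ (pow-true (suc (suc d))) (evalMon-replicate-0 a))
                   (trans (eval-extend-tail f true a) (xor-same (eval f a))) ⟩
  true ∎

zerosIn : ∀ {n} → (Vec Bool n → Bool) → List (Vec Bool n) → ℕ
zerosIn h as = length (filter (λ a → T? (isZero (h a))) as)

zerosIn-++ : ∀ {n} (h : Vec Bool n → Bool) as bs → zerosIn h (as ++ bs) ≡ zerosIn h as + zerosIn h bs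
zerosIn-++ h as bs = trans (cong length (filter-++ _ as bs)) (length-++ (filter _ as))

zerosIn-map-∷ : ∀ {n} (h : Vec Bool (suc n) → Bool) x as →
  zerosIn h (L.map (x ∷_) as) ≡ zerosIn (h ∘ (x ∷_)) as
zerosIn-map-∷ h x []       = refl
zerosIn-map-∷ h x (a ∷ as) with isZero (h (x ∷ a))
... | true  = cong suc (zerosIn-map-∷ h x as)
... | false = zerosIn-map-∷ h x as

zerosIn-cong : ∀ {n} {h g : Vec Bool n → Bool} → h ≗ g → ∀ as → zerosIn h as ≡ zerosIn g as
zerosIn-cong         h≗g []       = refl
zerosIn-cong {h = h} {g} h≗g (a ∷ as) with h a | g a | h≗g a
... | false | .false | refl = cong suc (zerosIn-cong h≗g as)
... | true  | .true  | refl = zerosIn-cong h≗g as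

zerosIn-true : ∀ {n} (as : List (Vec Bool n)) → zerosIn (λ _ → true) as ≡ 0
zerosIn-true []       = refl
zerosIn-true (a ∷ as) = zerosIn-true as

zerosIn-allPoints-suc : ∀ {n} (h : Vec Bool (suc n) → Bool) →
  zerosIn h (allPoints (suc n)) ≡ zerosIn (h ∘ (false ∷_)) (allPoints n) + zerosIn (h ∘ (true ∷_)) (allPoints n)
zerosIn-allPoints-suc {n} h = trans (zerosIn-++ h (L.map (false ∷_) P) (L.map (true ∷_) P))
                                    (cong₂ _+_ (zerosIn-map-∷ h false P) (zerosIn-map-∷ h true P))
  where P = allPoints n

zeroSetSize-extend : ∀ {n} d (f : Poly n) → zeroSetSize (extend d f) ≡ zeroSetSize f
zeroSetSize-extend {n} d f = begin
  zeroSetSize (extend d f)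
    ≡⟨ zerosIn-allPoints-suc (eval (extend d f)) ⟩
  zerosIn (eval (extend d f) ∘ (false ∷_)) P + zerosIn (eval (extend d f) ∘ (true ∷_)) P
    ≡⟨ cong₂ _+_ (zerosIn-cong (eval-extend-false d f) P)
                 (trans (zerosIn-cong (eval-extend-true d f) P) (zerosIn-true P)) ⟩
  zeroSetSize f + 0
    ≡⟨ +-identityʳ _ ⟩
  zeroSetSize f ∎
  where P = allPoints n

record AffineClosureFailure {n} (S : Vec Bool n → Set) : Set where
  constructor failure
  field
    a b c : Vec Bool n
    a∈S   : S a
    b∈S   : S b
    c∈S   : S c
    a⊕b⊕c∉S : ¬ S ((a ⊕ b) ⊕ c)

⊕-translate₃ : ∀ {n} (p u v w : Vec Bool n) → ((p ⊕ u) ⊕ (p ⊕ v)) ⊕ (p ⊕ w) ≡ p ⊕ ((u ⊕ v) ⊕ w)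
⊕-translate₃ []       []       []       []       = refl
⊕-translate₃ (p ∷ ps) (u ∷ us) (v ∷ vs) (w ∷ ws) = cong₂ _∷_ (translate₃ p u v w) (⊕-translate₃ ps us vs ws)
  where
  translate₃ : ∀ p u v w → ((p xor u) xor (p xor v)) xor (p xor w) ≡ p xor ((u xor v) xor w)
  translate₃ false u     v     w = refl
  translate₃ true  false false w = refl
  translate₃ true  false true  w = refl
  translate₃ true  true  false w = refl
  translate₃ true  true  true  w = refl

affine-⊕₃ : ∀ {n} {S : Vec Bool n → Set} → IsAffineSpace S →
  ∀ {a b c} → S a → S b → S c → S ((a ⊕ b) ⊕ c)
affine-⊕₃ (p , V , V-subspace , S≡p+V) a∈S b∈S c∈S
  with proj₁ (S≡p+V _) a∈S | proj₁ (S≡p+V _) b∈S | proj₁ (S≡p+V _) c∈S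
... | u , u∈V , a≡p⊕u | v , v∈V , b≡p⊕v | w , w∈V , c≡p⊕w =
  proj₂ (S≡p+V _) ((u ⊕ v) ⊕ w) (add-closed (add-closed u∈V v∈V) w∈V) (begin
    (_ ⊕ _) ⊕ _                     ≡⟨ cong₂ _⊕_ (cong₂ _⊕_ a≡p⊕u b≡p⊕v) c≡p⊕w ⟩
    ((p ⊕ u) ⊕ (p ⊕ v)) ⊕ (p ⊕ w)   ≡⟨ ⊕-translate₃ p u v w ⟩
    p ⊕ ((u ⊕ v) ⊕ w)               ∎)
  where open IsLinearSubspace V-subspace

failure⇒¬affine : ∀ {n} {S : Vec Bool n → Set} → AffineClosureFailure S → ¬ IsAffineSpace S
failure⇒¬affine (failure a b c a∈S b∈S c∈S a⊕b⊕c∉S) affine = a⊕b⊕c∉S (affine-⊕₃ affine a∈S b∈S c∈S)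

extend-failure : ∀ {n} d (f : Poly n) → AffineClosureFailure (Z f) → AffineClosureFailure (Z (extend d f))
extend-failure d f (failure a b c a∈Z b∈Z c∈Z a⊕b⊕c∉Z) =
  failure (false ∷ a) (false ∷ b) (false ∷ c)
          (trans (eval-extend-false d f a) a∈Z)
          (trans (eval-extend-false d f b) b∈Z)
          (trans (eval-extend-false d f c) c∈Z)
          (a⊕b⊕c∉Z ∘ trans (sym (eval-extend-false d f _)))

σ₂ : Poly 4
σ₂ = poly ms ms-distinct
  where
  ms : List (Monomial 4)
  ms = (0 ∷ 0 ∷ 1 ∷ 1 ∷ []) ∷ (0 ∷ 1 ∷ 0 ∷ 1 ∷ []) ∷ (0 ∷ 1 ∷ 1 ∷ 0 ∷ []) ∷
       (1 ∷ 0 ∷ 0 ∷ 1 ∷ []) ∷ (1 ∷ 0 ∷ 1 ∷ 0 ∷ []) ∷ (1 ∷ 1 ∷ 0 ∷ 0 ∷ []) ∷ []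
  ms-distinct : AllPairs _≢_ ms
  ms-distinct = ((λ ()) ∷ (λ ()) ∷ (λ ()) ∷ (λ ()) ∷ (λ ()) ∷ []) ∷
                ((λ ()) ∷ (λ ()) ∷ (λ ()) ∷ (λ ()) ∷ []) ∷
                ((λ ()) ∷ (λ ()) ∷ (λ ()) ∷ []) ∷
                ((λ ()) ∷ (λ ()) ∷ []) ∷
                ((λ ()) ∷ []) ∷ [] ∷ []

σ₂-isHomogeneousForm : IsHomogeneousForm 2 σ₂
σ₂-isHomogeneousForm = (λ ()) , refl ∷ refl ∷ refl ∷ refl ∷ refl ∷ refl ∷ []

σ₂-failure : AffineClosureFailure (Z σ₂)
σ₂-failure = failure (false ∷ false ∷ false ∷ false ∷ [])
                     (true  ∷ false ∷ false ∷ false ∷ [])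
                     (false ∷ true  ∷ false ∷ false ∷ [])
                     refl refl refl (λ ())

form : (k : ℕ) → Poly (suc (suc k) + 2)
form zero    = σ₂
form (suc k) = extend (suc k) (form k)

form-isHomogeneousForm : ∀ k → IsHomogeneousForm (suc (suc k)) (form k)
form-isHomogeneousForm zero    = σ₂-isHomogeneousForm
form-isHomogeneousForm (suc k) = extend-isHomogeneousForm (suc k) (form k) (proj₂ (form-isHomogeneousForm k))

form-zeroSetSize : ∀ k → zeroSetSize (form k) ≡ 6
form-zeroSetSize zero    = refl
form-zeroSetSize (suc k) = trans (zeroSetSize-extend (suc k) (form k)) (form-zeroSetSize k)

form-failure : ∀ k → AffineClosureFailure (Z (form k))
form-failure zero    = σ₂-failure
form-failure (suc k) = extend-failure (suc k) (form k) (form-failure k)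

proposition4p2 : (d : ℕ) → 2 ≤ d →
    Σ (Poly (d + 2)) λ f →
      IsHomogeneousForm d f × zeroSetSize f ≡ 6 × ¬ IsAffineSpace (Z f)
proposition4p2 (suc (suc k)) (s≤s (s≤s z≤n)) =
  form k , form-isHomogeneousForm k , form-zeroSetSize k , failure⇒¬affine (form-failure k)
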